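{- Let $(G,T,p)$ be an instance of Directed Vertex Multiway Cut and let $z$ be any vertex of $G$. Then there are at most $4^{p}$ members of $\mathcal{I}_p$ that contain $z$ in their exact reverse shadow.
   Context: $G$ is a directed graph with terminals $T$ and distinguished vertices $V^{\infty}(G)\supseteq T$, and $p$ is an integer. For disjoint nonempty $X,Y\subseteq V(G)$, a set $S\subseteq V(G)\setminus(X\cup Y\cup V^{\infty}(G))$ is an $X-Y$ separator if $G\setminus S$ has no directed path from $X$ to $Y$; it is minimal if no proper subset is an $X-Y$ separator. $R^{+}_{H}(X)$ is the set of vertices reachable from $X$ in $H$. A minimal $X-Y$ separator $S$ is important if there is no $X-Y$ separator $S'$ with $|S'|\le |S|$ and $R^{+}_{G\setminus S}(X)\subsetneq R^{+}_{G\setminus S'}(X)$. We write $v-T$ for $\{v\}-T$. $\mathcal{I}_p$ is the collection of all sets $S\subseteq V(G)$ such that $S$ is an important $v-T$ separator of size at most $p$ for some $v\in V(G)\setminus T$. A vertex $v$ is in the exact reverse shadow of $S\subseteq V(G)\setminus V^{\infty}(G)$ if $S$ is a minimal $v-T$ separator. -}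

module Defs where

open import Data.Nat using (ℕ; _≤_)
open import Data.Fin using (Fin)
open import Data.Fin.Subset using (Subset; _∈_; _∉_; _⊂_; ⁅_⁆; ∣_∣; Nonempty)
open import Data.Product using (Σ; ∃; _×_)
open import Relation.Nullary using (¬_)

data Reach {n : ℕ} (E : Fin n → Fin n → Set) (S : Subset n) : Fin n → Fin n → Set where
  here : ∀ {x} → x ∉ S → Reach E S x x
  step : ∀ {x y w} → x ∉ S → E x y → Reach E S y w → Reach E S x w

Reachable : {n : ℕ} → (Fin n → Fin n → Set) → Subset n → Subset n → Fin n → Set
Reachable E S X v = ∃ λ x → x ∈ X × Reach E S x v

module _ {n : ℕ} (E : Fin n → Fin n → Set) (Vinf : Subset n) where

  IsSeparator : Subset n → Subset n → Subset n → Set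
  IsSeparator X Y S =
    Nonempty X × Nonempty Y × (∀ v → v ∈ X → v ∉ Y)
    × (∀ v → v ∈ S → v ∉ X × v ∉ Y × v ∉ Vinf)
    × (∀ x y → x ∈ X → y ∈ Y → ¬ Reach E S x y)

  IsMinimalSeparator : Subset n → Subset n → Subset n → Set
  IsMinimalSeparator X Y S =
    IsSeparator X Y S × (∀ S' → S' ⊂ S → ¬ IsSeparator X Y S')

  StrictlyIncluded : (Fin n → Set) → (Fin n → Set) → Set
  StrictlyIncluded A B = (∀ v → A v → B v) × (∃ λ v → B v × ¬ A v)

  IsImportantSeparator : Subset n → Subset n → Subset n → Set
  IsImportantSeparator X Y S =
    IsMinimalSeparator X Y S ×
    (¬ (∃ λ S' → IsSeparator X Y S' × ∣ S' ∣ ≤ ∣ S ∣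
                 × StrictlyIncluded (Reachable E S X) (Reachable E S' X)))

  InI : Subset n → ℕ → Subset n → Set
  InI T p S = ∃ λ v → v ∉ T × IsImportantSeparator ⁅ v ⁆ T S × ∣ S ∣ ≤ p

  InExactReverseShadow : Subset n → Subset n → Fin n → Set
  InExactReverseShadow T S z =
    (∀ v → v ∈ S → v ∉ Vinf) × IsMinimalSeparator ⁅ z ⁆ T S

module Submission where

-- If S ∈ 𝓘_p (an important v–T separator) is a minimal z–T separator, then
-- the set R of vertices reachable from z in G ∖ S has cut ∂R = S, and R is an important
-- {z}–T cut in the sense of reach sets: a closed R′ ⊃ R with |∂R′| ≤ |∂R| would yield,
-- via ∂(A ∪ R′) with A the reach set of v, a v–T separator contradicting the importance
-- of S (module Exchange).  So S ↦ R is injective into the important {z}-cuts of cost ≤ p,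
-- and these number at most 2^(2p) = 4^p by the classical branching argument: cut costs
-- are submodular, so there is a furthest minimum cut K contained in every important cut;
-- a vertex u ∈ ∂K either lies in the cut (delete u: budget and minimum drop by one) or
-- inside it (make u a source: the minimum rises by one), and 2k − minimum drops in both.

open import Defs
open import Data.Nat using (ℕ; _≤_; _^_)
open import Data.Fin using (Fin)
open import Data.Fin.Subset using (Subset; _⊆_)
open import Data.List using (List; length)
open import Data.List.Relation.Unary.All using (All)
open import Data.List.Relation.Unary.Unique.Propositional using (Unique)
open import Data.Product using (_×_)

open import Level using (0ℓ)
open import Function using (_∘_; _⇔_; mk⇔; Equivalence)
open import Data.Nat using (zero; suc; _+_; _<_; z≤n; s≤s; _≤?_)
open import Data.Nat.Properties
  using ( ≤-refl; ≤-trans; ≤-reflexive; ≤-antisym; ≤-pred; ≮⇒≥; ≰⇒>; <⇒≱; >⇒≢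
        ; ≤∧≢⇒<; m≤m+n; +-suc; +-identityʳ; +-mono-≤; +-monoʳ-≤
        ; +-cancelˡ-≤; +-cancelʳ-≤; ^-*-assoc; m^n>0; module ≤-Reasoning )
open import Data.Fin using (zero; suc; _≟_)
open import Data.Fin.Properties using (any?)
open import Data.Fin.Subset
  using (_∈_; _∉_; _⊂_; _∪_; _∩_; ∁; _-_; ⁅_⁆; ∣_∣; Nonempty; inside; outside)
  renaming (⊥ to ∅)
open import Data.Fin.Subset.Properties
  using ( _∈?_; ∉⊥; ⊆-min; ⊆-antisym; nonempty?; Empty-unique; ∣⊥∣≡0; ∣⁅x⁆∣≡1
        ; p⊆q⇒∣p∣≤∣q∣; p⊂q⇒∣p∣<∣q∣; x∈⁅x⁆; x∈⁅y⁆⇒x≡y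
        ; x∈p∪q⁺; x∈p∪q⁻; p⊆p∪q; q⊆p∪q; x∈p∩q⁺; x∈p∩q⁻; p∩q⊆p
        ; x∈p⇒x∉∁p; x∉∁p⇒x∈p; x∈∁p⇒x∉p; x∉p⇒x∈∁p; p⊆q⇒∁p⊇∁q; p⊂q⇒∁p⊃∁q
        ; x∈p∧x≢y⇒x∈p-y; x∈p⇒p-x⊂p; p─q⊆p )
open import Data.Vec using ([]; _∷_; tabulate)
open import Data.Vec.Properties using (lookup∘tabulate; lookup⇒[]=; []=⇒lookup)
open import Data.List using ([]; _∷_; map; filter)
open import Data.List.Properties using (length-map)
import Data.List.Relation.Unary.All as All
open import Data.List.Relation.Unary.All using ([]; _∷_)
open import Data.List.Relation.Unary.All.Properties using (all-filter; filter⁺)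
import Data.List.Relation.Unary.AllPairs as AllPairs
import Data.List.Relation.Unary.Unique.Propositional.Properties as Unique
open import Data.Product using (∃; _,_; proj₁; proj₂)
open import Data.Sum using (_⊎_; inj₁; inj₂; [_,_]′)
open import Effect.Monad using (RawMonad)
open import Relation.Binary.Definitions using (Decidable)
open import Relation.Binary.PropositionalEquality
  using (_≡_; _≢_; refl; sym; trans; cong; subst; subst₂)
open import Relation.Nullary using (¬_; Dec; yes; no; does; ¬?; _×-dec_)
open import Relation.Nullary.Decidable using (dec-true; decidable-stable; ¬¬-excluded-middle)
open import Relation.Nullary.Negation using (¬¬-Monad; DoubleNegation; contradiction)

open RawMonad (¬¬-Monad {0ℓ}) using (_>>=_; return)
open Equivalence using (to; from)

-- Classical reasoning.  Every goal below that is decided by a computation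
-- (an inequality of natural numbers) may be proved in the double-negation monad.

¬¬-∀Fin : ∀ {n} {P : Fin n → Set} → (∀ i → DoubleNegation (P i)) → DoubleNegation (∀ i → P i)
¬¬-∀Fin {zero} _ = return λ ()
¬¬-∀Fin {suc _} h = do
  p₀ ← h zero
  ps ← ¬¬-∀Fin (h ∘ suc)
  return λ { zero → p₀ ; (suc i) → ps i }

¬¬-decidable : ∀ {n} (R : Fin n → Fin n → Set) → DoubleNegation (Decidable R)
¬¬-decidable R = ¬¬-∀Fin λ x → ¬¬-∀Fin λ y → ¬¬-excluded-middle

¬¬-minimum : {A : Set} (Q : A → Set) (f : A → ℕ) {a : A} → Q a →
  DoubleNegation (∃ λ m → Q m × ∀ b → Q b → f m ≤ f b)
¬¬-minimum Q f {a} qa = descend (suc (f a)) a qa ≤-refl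
  where
  descend : ∀ k a → Q a → f a < k → DoubleNegation (∃ λ m → Q m × ∀ b → Q b → f m ≤ f b)
  descend (suc k) a qa (s≤s fa≤k) = do
    yes (b , qb , fb<fa) ← ¬¬-excluded-middle {A = ∃ λ b → Q b × f b < f a}
      where no none → return (a , qa , λ b qb → ≮⇒≥ λ fb<fa → none (b , qb , fb<fa))
    descend k b qb (≤-trans fb<fa fa≤k)

infix 4 _≐_
_≐_ : ∀ {n} → Subset n → (Fin n → Set) → Set
A ≐ P = ∀ {i} → i ∈ A ⇔ P i

⟦_⟧ : ∀ {n} {P : Fin n → Set} → (∀ i → Dec (P i)) → Subset n
⟦ P? ⟧ = tabulate (does ∘ P?)

⟦⟧-≐ : ∀ {n} {P : Fin n → Set} (P? : ∀ i → Dec (P i)) → ⟦ P? ⟧ ≐ P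
⟦⟧-≐ P? {i} = mk⇔ ∈⇒ ⇒∈
  where
  ⇒∈ : _ → i ∈ ⟦ P? ⟧
  ⇒∈ p = lookup⇒[]= i _ (trans (lookup∘tabulate _ i) (dec-true (P? i) p))
  ∈⇒ : i ∈ ⟦ P? ⟧ → _
  ∈⇒ m with P? i | trans (sym (lookup∘tabulate (does ∘ P?) i)) ([]=⇒lookup m)
  ... | yes p | _ = p
  ... | no _  | ()

¬¬-comprehension : ∀ {n} (P : Fin n → Set) → DoubleNegation (∃ λ A → A ≐ P)
¬¬-comprehension P = do
  P? ← ¬¬-∀Fin λ _ → ¬¬-excluded-middle
  return (⟦ P? ⟧ , λ {i} → ⟦⟧-≐ P? {i})

∣p∪q∣+∣p∩q∣≡∣p∣+∣q∣ : ∀ {n} (p q : Subset n) → ∣ p ∪ q ∣ + ∣ p ∩ q ∣ ≡ ∣ p ∣ + ∣ q ∣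
∣p∪q∣+∣p∩q∣≡∣p∣+∣q∣ [] [] = refl
∣p∪q∣+∣p∩q∣≡∣p∣+∣q∣ (inside ∷ p) (inside ∷ q) =
  cong suc (trans (+-suc _ _) (trans (cong suc (∣p∪q∣+∣p∩q∣≡∣p∣+∣q∣ p q)) (sym (+-suc _ _))))
∣p∪q∣+∣p∩q∣≡∣p∣+∣q∣ (inside ∷ p) (outside ∷ q) = cong suc (∣p∪q∣+∣p∩q∣≡∣p∣+∣q∣ p q)
∣p∪q∣+∣p∩q∣≡∣p∣+∣q∣ (outside ∷ p) (inside ∷ q) =
  trans (cong suc (∣p∪q∣+∣p∩q∣≡∣p∣+∣q∣ p q)) (sym (+-suc _ _))
∣p∪q∣+∣p∩q∣≡∣p∣+∣q∣ (outside ∷ p) (outside ∷ q) = ∣p∪q∣+∣p∩q∣≡∣p∣+∣q∣ p q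

∣p∪q∣≤∣p∣+∣q∣ : ∀ {n} (p q : Subset n) → ∣ p ∪ q ∣ ≤ ∣ p ∣ + ∣ q ∣
∣p∪q∣≤∣p∣+∣q∣ p q = ≤-trans (m≤m+n _ _) (≤-reflexive (∣p∪q∣+∣p∩q∣≡∣p∣+∣q∣ p q))

∣∣-submodular : ∀ {n} {P Q A B : Subset n} → P ∪ Q ⊆ A ∪ B → P ∩ Q ⊆ A ∩ B →
  ∣ P ∣ + ∣ Q ∣ ≤ ∣ A ∣ + ∣ B ∣
∣∣-submodular {P = P} {Q} {A} {B} ∪⊆ ∩⊆ = begin
  ∣ P ∣ + ∣ Q ∣             ≡⟨ ∣p∪q∣+∣p∩q∣≡∣p∣+∣q∣ P Q ⟨
  ∣ P ∪ Q ∣ + ∣ P ∩ Q ∣     ≤⟨ +-mono-≤ (p⊆q⇒∣p∣≤∣q∣ ∪⊆) (p⊆q⇒∣p∣≤∣q∣ ∩⊆) ⟩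
  ∣ A ∪ B ∣ + ∣ A ∩ B ∣     ≡⟨ ∣p∪q∣+∣p∩q∣≡∣p∣+∣q∣ A B ⟩
  ∣ A ∣ + ∣ B ∣             ∎
  where open ≤-Reasoning

∈⇒∣∣>0 : ∀ {n} {p : Subset n} {x} → x ∈ p → 0 < ∣ p ∣
∈⇒∣∣>0 {n} {p} {x} x∈p = subst (_< ∣ p ∣) (∣⊥∣≡0 n) (p⊂q⇒∣p∣<∣q∣ (⊆-min p , x , x∈p , ∉⊥))

∣∣>0⇒nonempty : ∀ {n} (p : Subset n) → 0 < ∣ p ∣ → Nonempty p
∣∣>0⇒nonempty {n} p ∣p∣>0 with nonempty? p
... | yes ne = ne
... | no empty = contradiction (trans (cong ∣_∣ (Empty-unique empty)) (∣⊥∣≡0 n)) (>⇒≢ ∣p∣>0)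

∉∪ : ∀ {n} {A B : Subset n} {w} → w ∉ A ∪ B → w ∉ A × w ∉ B
∉∪ {A = A} {B} w∉A∪B = w∉A∪B ∘ p⊆p∪q B , w∉A∪B ∘ q⊆p∪q A B

∉∩ : ∀ {n} {A B : Subset n} {w} → w ∉ A ∩ B → w ∉ A ⊎ w ∉ B
∉∩ {A = A} {B} {w} w∉A∩B with w ∈? A
... | yes w∈A = inj₂ λ w∈B → w∉A∩B (x∈p∩q⁺ (w∈A , w∈B))
... | no w∉A  = inj₁ w∉A

∉-remove : ∀ {n} {p : Subset n} {x y} → x ∉ p - y → x ≢ y → x ∉ p
∉-remove x∉p-y x≢y x∈p = x∉p-y (x∈p∧x≢y⇒x∈p-y x∈p x≢y)

least-complement-maximal : ∀ {n} {Q : Subset n → Set} {M R} →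
  (∀ B → Q B → ∣ ∁ M ∣ ≤ ∣ ∁ B ∣) → Q R → M ⊆ R → R ⊆ M
least-complement-maximal {M = M} {R} least qR M⊆R {v} v∈R with v ∈? M
... | yes v∈M = v∈M
... | no v∉M = contradiction (least R qR) (<⇒≱ (p⊂q⇒∣p∣<∣q∣ (p⊂q⇒∁p⊃∁q (M⊆R , v , v∈R , v∉M))))

-- Arithmetic of the counting measure 2k − l (budget k, minimum cut cost l), kept as
-- the inequality k + k ≤ m + l: it drops by one when k and l both drop by one, or
-- when l rises by one; it forbids l > 0 when m = 0.

budget-delete : ∀ {k m l} → suc k + suc k ≤ suc m + suc l → k + k ≤ m + l
budget-delete {k} {m} {l} h =
  ≤-pred (≤-pred (subst₂ _≤_ (cong suc (+-suc k k)) (cong suc (+-suc m l)) h))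

budget-add-source : ∀ {k m l} → k + k ≤ suc m + l → k + k ≤ m + suc l
budget-add-source {k} {m} {l} h = subst (k + k ≤_) (sym (+-suc m l)) h

budget-exhausted : ∀ {k l} → l ≤ k → ¬ (suc k + suc k ≤ suc l)
budget-exhausted {k} l≤k h with +-cancelˡ-≤ (suc k) (suc k) 0
  (≤-trans h (≤-trans (s≤s l≤k) (≤-reflexive (sym (+-identityʳ (suc k))))))
... | ()

2^m+2^m≡2^[1+m] : ∀ m → 2 ^ m + 2 ^ m ≡ 2 ^ suc m
2^m+2^m≡2^[1+m] m = cong (2 ^ m +_) (sym (+-identityʳ (2 ^ m)))

2^[p+p]≡4^p : ∀ p → 2 ^ (p + p) ≡ 4 ^ p
2^[p+p]≡4^p p = trans (cong (λ q → 2 ^ (p + q)) (sym (+-identityʳ p))) (sym (^-*-assoc 2 2 p))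

length-filter-split : ∀ {A : Set} {P : A → Set} (P? : ∀ x → Dec (P x)) xs →
  length (filter P? xs) + length (filter (¬? ∘ P?) xs) ≡ length xs
length-filter-split P? [] = refl
length-filter-split P? (x ∷ xs) with P? x
... | yes _ = cong suc (length-filter-split P? xs)
... | no _  = trans (+-suc _ _) (cong suc (length-filter-split P? xs))

unique-constant : ∀ {A : Set} {a : A} {xs} → Unique xs → All (_≡ a) xs → length xs ≤ 1
unique-constant AllPairs.[] _ = z≤n
unique-constant (_ AllPairs.∷ AllPairs.[]) _ = s≤s z≤n
unique-constant ((x≢y ∷ _) AllPairs.∷ _) (refl ∷ refl ∷ _) = contradiction refl x≢y

¬¬-preimages : ∀ {A B : Set} {P : A → Set} {Q : B → Set} (f : B → A) →
  (∀ {a} → P a → DoubleNegation (∃ λ b → Q b × f b ≡ a)) →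
  ∀ {xs} → All P xs → DoubleNegation (∃ λ ys → All Q ys × map f ys ≡ xs)
¬¬-preimages f lift [] = return ([] , [] , refl)
¬¬-preimages f lift (px ∷ pxs) = do
  (y , qy , refl) ← lift px
  (ys , qys , refl) ← ¬¬-preimages f lift pxs
  return (y ∷ ys , qy ∷ qys , refl)

-- Walks.  Reach E S x w is a walk from x to w avoiding S; a walk inside R is one
-- avoiding the complement ∁ R.

module Walks {n : ℕ} (E : Fin n → Fin n → Set) where

  reach-start : ∀ {S x w} → Reach E S x w → x ∉ S
  reach-start (here x∉S) = x∉S
  reach-start (step x∉S _ _) = x∉S

  reach-end : ∀ {S x w} → Reach E S x w → w ∉ S
  reach-end (here w∉S) = w∉S
  reach-end (step _ _ walk) = reach-end walk

  reach-snoc : ∀ {S x u w} → Reach E S x u → E u w → w ∉ S → Reach E S x w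
  reach-snoc (here x∉S) e w∉S = step x∉S e (here w∉S)
  reach-snoc (step x∉S e walk) e′ w∉S = step x∉S e (reach-snoc walk e′ w∉S)

  reach-++ : ∀ {S x u w} → Reach E S x u → Reach E S u w → Reach E S x w
  reach-++ (here _) walk′ = walk′
  reach-++ (step x∉S e walk) walk′ = step x∉S e (reach-++ walk walk′)

  reach-mono : ∀ {S S′ x w} → S′ ⊆ S → Reach E S x w → Reach E S′ x w
  reach-mono S′⊆S (here w∉S) = here (w∉S ∘ S′⊆S)
  reach-mono S′⊆S (step x∉S e walk) = step (x∉S ∘ S′⊆S) e (reach-mono S′⊆S walk)

  reachable-mono : ∀ {S S′ X w} → S′ ⊆ S → Reachable E S X w → Reachable E S′ X w
  reachable-mono S′⊆S (x , x∈X , walk) = x , x∈X , reach-mono S′⊆S walk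

  escape : ∀ {S R x w} → x ∈ R → Reach E S x w →
    w ∈ R ⊎ ∃ λ s → s ∉ S × s ∉ R × ∃ λ u → u ∈ R × E u s
  escape x∈R (here _) = inj₁ x∈R
  escape {R = R} x∈R (step {y = y} _ e walk) with y ∈? R
  ... | yes y∈R = escape y∈R walk
  ... | no y∉R = inj₂ (y , reach-start walk , y∉R , _ , x∈R , e)

  first-visit : ∀ {S s a w} → Reach E (S - s) a w →
    Reach E S a w ⊎ a ≡ s ⊎ ∃ λ u → Reach E S a u × E u s
  first-visit {s = s} {a} (here a∉) with a ≟ s
  ... | yes a≡s = inj₂ (inj₁ a≡s)
  ... | no a≢s  = inj₁ (here (∉-remove a∉ a≢s))
  first-visit {s = s} {a} (step a∉ e walk) with a ≟ s
  ... | yes a≡s = inj₂ (inj₁ a≡s)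
  ... | no a≢s with first-visit walk
  ...   | inj₁ walk′ = inj₁ (step (∉-remove a∉ a≢s) e walk′)
  ...   | inj₂ (inj₁ refl) = inj₂ (inj₂ (a , here (∉-remove a∉ a≢s) , e))
  ...   | inj₂ (inj₂ (u , walk-u , e′)) = inj₂ (inj₂ (u , step (∉-remove a∉ a≢s) e walk-u , e′))

  reachable-inside : ∀ {S X A x w} → A ≐ Reachable E S X →
    Reachable E S X x → Reach E S x w → Reach E (∁ A) x w
  reachable-inside A≐ x-reachable (here _) = here (x∈p⇒x∉∁p (from A≐ x-reachable))
  reachable-inside A≐ (a , a∈X , walk-x) (step x∉S e walk) =
    step (x∈p⇒x∉∁p (from A≐ (a , a∈X , walk-x))) e
         (reachable-inside A≐ (a , a∈X , reach-snoc walk-x e (reach-start walk)) walk)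

  reachable-closed : ∀ {S X A w} → A ≐ Reachable E S X → w ∈ A → Reachable E (∁ A) X w
  reachable-closed A≐ w∈A with to A≐ w∈A
  ... | x , x∈X , walk = x , x∈X , reachable-inside A≐ (x , x∈X , here (reach-start walk)) walk

-- Cuts in a digraph with decidable arcs, terminals T and undeletable vertices Vinf.
-- A vertex set F is regarded as deleted from the graph.

module Cuts {n : ℕ} (E : Fin n → Fin n → Set) (E? : Decidable E) (T Vinf : Subset n) where

  open Walks E

  Boundary : Subset n → Subset n → Fin n → Set
  Boundary F R w = w ∉ R × w ∉ F × ∃ λ u → u ∈ R × E u w

  boundary? : ∀ F R w → Dec (Boundary F R w)
  boundary? F R w =
    ¬? (w ∈? R) ×-dec ¬? (w ∈? F) ×-dec any? λ u → u ∈? R ×-dec E? u w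

  ∂ : Subset n → Subset n → Subset n
  ∂ F R = ⟦ boundary? F R ⟧

  cost : Subset n → Subset n → ℕ
  cost F R = ∣ ∂ F R ∣

  ∂⁺ : ∀ {F R u w} → w ∉ R → w ∉ F → u ∈ R → E u w → w ∈ ∂ F R
  ∂⁺ w∉R w∉F u∈R e = from (⟦⟧-≐ (boundary? _ _)) (w∉R , w∉F , _ , u∈R , e)

  ∂⁻ : ∀ {F R w} → w ∈ ∂ F R → Boundary F R w
  ∂⁻ = to (⟦⟧-≐ (boundary? _ _))

  ∂-∪ : ∀ {F A B} → ∂ F (A ∪ B) ⊆ ∂ F A ∪ ∂ F B
  ∂-∪ {A = A} {B} m with ∂⁻ m
  ... | w∉A∪B , w∉F , u , u∈A∪B , e with ∉∪ w∉A∪B | x∈p∪q⁻ A B u∈A∪B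
  ... | w∉A , _ | inj₁ u∈A = x∈p∪q⁺ (inj₁ (∂⁺ w∉A w∉F u∈A e))
  ... | _ , w∉B | inj₂ u∈B = x∈p∪q⁺ (inj₂ (∂⁺ w∉B w∉F u∈B e))

  ∂-∩ : ∀ {F A B} → ∂ F (A ∩ B) ⊆ ∂ F A ∪ ∂ F B
  ∂-∩ {A = A} {B} m with ∂⁻ m
  ... | w∉A∩B , w∉F , u , u∈A∩B , e with x∈p∩q⁻ A B u∈A∩B | ∉∩ w∉A∩B
  ... | u∈A , _ | inj₁ w∉A = x∈p∪q⁺ (inj₁ (∂⁺ w∉A w∉F u∈A e))
  ... | _ , u∈B | inj₂ w∉B = x∈p∪q⁺ (inj₂ (∂⁺ w∉B w∉F u∈B e))

  ∂-∪∩ : ∀ {F A B} → ∂ F (A ∪ B) ∩ ∂ F (A ∩ B) ⊆ ∂ F A ∩ ∂ F B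
  ∂-∪∩ {A = A} {B} m with x∈p∩q⁻ _ _ m
  ... | m∪ , m∩ with ∂⁻ m∪ | ∂⁻ m∩
  ... | w∉A∪B , w∉F , _ | _ , _ , u , u∈A∩B , e with ∉∪ w∉A∪B | x∈p∩q⁻ A B u∈A∩B
  ... | w∉A , w∉B | u∈A , u∈B = x∈p∩q⁺ (∂⁺ w∉A w∉F u∈A e , ∂⁺ w∉B w∉F u∈B e)

  cost-submodular : ∀ {F} A B → cost F (A ∪ B) + cost F (A ∩ B) ≤ cost F A + cost F B
  cost-submodular A B = ∣∣-submodular
    (λ m → [ ∂-∪ , ∂-∩ ]′ (x∈p∪q⁻ _ _ m))
    ∂-∪∩

  record IsCut (X F R : Subset n) : Set where
    field
      sources       : X ⊆ R
      terminal-free : ∀ {v} → v ∈ R → v ∉ T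
      deletion-free : ∀ {v} → v ∈ R → v ∉ F
      deletable     : ∀ {v} → v ∈ ∂ F R → v ∉ Vinf

  open IsCut

  Closed : Subset n → Subset n → Set
  Closed X R = ∀ {v} → v ∈ R → Reachable E (∁ R) X v

  record Important (X F R : Subset n) : Set where
    field
      cut       : IsCut X F R
      closed    : Closed X R
      important : ∀ {R′} → IsCut X F R′ → Closed X R′ → R ⊂ R′ → cost F R < cost F R′

  open Important

  cut-∪ : ∀ {X F A B} → IsCut X F A → IsCut X F B → IsCut X F (A ∪ B)
  cut-∪ {A = A} {B} a b = record
    { sources       = p⊆p∪q B ∘ sources a
    ; terminal-free = λ m → [ terminal-free a , terminal-free b ]′ (x∈p∪q⁻ A B m)
    ; deletion-free = λ m → [ deletion-free a , deletion-free b ]′ (x∈p∪q⁻ A B m)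
    ; deletable     = λ m → [ deletable a , deletable b ]′ (x∈p∪q⁻ _ _ (∂-∪ m))
    }

  cut-∩ : ∀ {X F A B} → IsCut X F A → IsCut X F B → IsCut X F (A ∩ B)
  cut-∩ {A = A} {B} a b = record
    { sources       = λ x∈X → x∈p∩q⁺ (sources a x∈X , sources b x∈X)
    ; terminal-free = terminal-free a ∘ p∩q⊆p A B
    ; deletion-free = deletion-free a ∘ p∩q⊆p A B
    ; deletable     = λ m → [ deletable a , deletable b ]′ (x∈p∪q⁻ _ _ (∂-∩ m))
    }

  closed-∪ : ∀ {X A B} → Closed X A → Closed X B → Closed X (A ∪ B)
  closed-∪ {A = A} {B} ca cb m with x∈p∪q⁻ A B m
  ... | inj₁ v∈A = reachable-mono (p⊆q⇒∁p⊇∁q (p⊆p∪q B)) (ca v∈A)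
  ... | inj₂ v∈B = reachable-mono (p⊆q⇒∁p⊇∁q (q⊆p∪q A B)) (cb v∈B)

  cost-∪-minimum : ∀ {X F A B l} → (∀ {R} → IsCut X F R → l ≤ cost F R) →
    IsCut X F A → IsCut X F B → cost F B ≡ l → cost F (A ∪ B) ≤ cost F A
  cost-∪-minimum {F = F} {A} {B} {l} minimum A-cut B-cut B-cost = +-cancelʳ-≤ l _ _ (begin
    cost F (A ∪ B) + l               ≤⟨ +-monoʳ-≤ _ (minimum (cut-∩ A-cut B-cut)) ⟩
    cost F (A ∪ B) + cost F (A ∩ B)  ≤⟨ cost-submodular A B ⟩
    cost F A + cost F B              ≡⟨ cong (cost F A +_) B-cost ⟩
    cost F A + l                     ∎)
    where open ≤-Reasoning

  important-⊇-minimum : ∀ {X F R K l} → (∀ {R} → IsCut X F R → l ≤ cost F R) →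
    Important X F R → IsCut X F K → Closed X K → cost F K ≡ l → K ⊆ R
  important-⊇-minimum {R = R} {K} minimum imp K-cut K-closed K-cost {v} v∈K with v ∈? R
  ... | yes v∈R = v∈R
  ... | no v∉R = contradiction
    (cost-∪-minimum minimum (cut imp) K-cut K-cost)
    (<⇒≱ (important imp (cut-∪ (cut imp) K-cut) (closed-∪ (closed imp) K-closed)
                         (p⊆p∪q K , v , q⊆p∪q R K v∈K , v∉R)))

  ∂-delete⊆ : ∀ {F R u} → ∂ (F ∪ ⁅ u ⁆) R ⊆ ∂ F R
  ∂-delete⊆ m with ∂⁻ m
  ... | w∉R , w∉F∪u , _ , u∈R , e = ∂⁺ w∉R (proj₁ (∉∪ w∉F∪u)) u∈R e

  ∂⊆delete : ∀ {F R u} → ∂ F R ⊆ ⁅ u ⁆ ∪ ∂ (F ∪ ⁅ u ⁆) R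
  ∂⊆delete {F} {R} {u} {w} m with w ≟ u | ∂⁻ m
  ... | yes refl | _ = x∈p∪q⁺ (inj₁ (x∈⁅x⁆ w))
  ... | no w≢u | w∉R , w∉F , _ , u∈R , e = x∈p∪q⁺ (inj₂ (∂⁺ w∉R w∉F∪u u∈R e))
    where
    w∉F∪u : w ∉ F ∪ ⁅ u ⁆
    w∉F∪u m′ = [ w∉F , w≢u ∘ x∈⁅y⁆⇒x≡y u ]′ (x∈p∪q⁻ F ⁅ u ⁆ m′)

  cost-undelete : ∀ {F R u} → cost F R ≤ suc (cost (F ∪ ⁅ u ⁆) R)
  cost-undelete {F} {R} {u} = begin
    cost F R                               ≤⟨ p⊆q⇒∣p∣≤∣q∣ (∂⊆delete {F} {R} {u}) ⟩
    ∣ ⁅ u ⁆ ∪ ∂ (F ∪ ⁅ u ⁆) R ∣            ≤⟨ ∣p∪q∣≤∣p∣+∣q∣ ⁅ u ⁆ _ ⟩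
    ∣ ⁅ u ⁆ ∣ + cost (F ∪ ⁅ u ⁆) R         ≡⟨ cong (_+ cost (F ∪ ⁅ u ⁆) R) (∣⁅x⁆∣≡1 u) ⟩
    suc (cost (F ∪ ⁅ u ⁆) R)               ∎
    where open ≤-Reasoning

  cost-delete : ∀ {F R u} → u ∈ ∂ F R → suc (cost (F ∪ ⁅ u ⁆) R) ≤ cost F R
  cost-delete {u = u} u∈∂ = p⊂q⇒∣p∣<∣q∣
    (∂-delete⊆ , u , u∈∂ , λ m → proj₁ (proj₂ (∂⁻ m)) (x∈p∪q⁺ (inj₂ (x∈⁅x⁆ u))))

  cut-undelete : ∀ {X F R u} → u ∉ Vinf → IsCut X (F ∪ ⁅ u ⁆) R → IsCut X F R
  cut-undelete {u = u} u∉Vinf c = record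
    { sources       = sources c
    ; terminal-free = terminal-free c
    ; deletion-free = proj₁ ∘ ∉∪ ∘ deletion-free c
    ; deletable     = λ m → [ (λ v∈u → subst (_∉ Vinf) (sym (x∈⁅y⁆⇒x≡y u v∈u)) u∉Vinf)
                            , deletable c ]′ (x∈p∪q⁻ _ _ (∂⊆delete m))
    }

  cut-delete : ∀ {X F R u} → u ∈ ∂ F R → IsCut X F R → IsCut X (F ∪ ⁅ u ⁆) R
  cut-delete {F = F} {R} {u} u∈∂ c = record
    { sources       = sources c
    ; terminal-free = terminal-free c
    ; deletion-free = λ v∈R m → [ deletion-free c v∈R
                                , (λ v∈u → proj₁ (∂⁻ u∈∂) (subst (_∈ R) (x∈⁅y⁆⇒x≡y u v∈u) v∈R))
                                ]′ (x∈p∪q⁻ F ⁅ u ⁆ m)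
    ; deletable     = deletable c ∘ ∂-delete⊆
    }

  important-delete : ∀ {X F R u} → u ∈ ∂ F R → Important X F R → Important X (F ∪ ⁅ u ⁆) R
  important-delete u∈∂ imp = record
    { cut       = cut-delete u∈∂ (cut imp)
    ; closed    = closed imp
    ; important = λ c′ closed′ R⊂R′ →
        let cheaper = important imp (cut-undelete (deletable (cut imp) u∈∂) c′) closed′ R⊂R′
        in ≤-pred (≤-trans (s≤s (cost-delete u∈∂)) (≤-trans cheaper cost-undelete))
    }

  cut-fewer-sources : ∀ {X X′ F R} → X ⊆ X′ → IsCut X′ F R → IsCut X F R
  cut-fewer-sources X⊆X′ c = record
    { sources = sources c ∘ X⊆X′ ; terminal-free = terminal-free c
    ; deletion-free = deletion-free c ; deletable = deletable c }

  closed-fewer-sources : ∀ {X R R′ u} → Closed X R → u ∈ R → R ⊆ R′ →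
    Closed (X ∪ ⁅ u ⁆) R′ → Closed X R′
  closed-fewer-sources {X} {R} {u = u} closed-R u∈R R⊆R′ closed-R′ v∈R′ with closed-R′ v∈R′
  ... | x , x∈X∪u , walk with x∈p∪q⁻ X ⁅ u ⁆ x∈X∪u
  ...   | inj₁ x∈X = x , x∈X , walk
  ...   | inj₂ x∈u with closed-R (subst (_∈ R) (sym (x∈⁅y⁆⇒x≡y u x∈u)) u∈R)
  ...     | a , a∈X , walk-a = a , a∈X , reach-++ (reach-mono (p⊆q⇒∁p⊇∁q R⊆R′) walk-a) walk

  important-add-source : ∀ {X F R u} → u ∈ R → Important X F R → Important (X ∪ ⁅ u ⁆) F R
  important-add-source {X} {R = R} {u} u∈R imp = record
    { cut       = record
        { sources = sources′ ; terminal-free = terminal-free (cut imp)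
        ; deletion-free = deletion-free (cut imp) ; deletable = deletable (cut imp) }
    ; closed    = λ v∈R → let (x , x∈X , walk) = closed imp v∈R in x , p⊆p∪q ⁅ u ⁆ x∈X , walk
    ; important = λ c′ closed′ R⊂R′ → important imp (cut-fewer-sources (p⊆p∪q ⁅ u ⁆) c′)
        (closed-fewer-sources (closed imp) u∈R (proj₁ R⊂R′) closed′) R⊂R′
    }
    where
    sources′ : X ∪ ⁅ u ⁆ ⊆ R
    sources′ m = [ sources (cut imp) , (λ v∈u → subst (_∈ R) (sym (x∈⁅y⁆⇒x≡y u v∈u)) u∈R) ]′
                 (x∈p∪q⁻ X ⁅ u ⁆ m)

  ∂-reachable : ∀ {S X A F} → A ≐ Reachable E S X → ∂ F A ⊆ S
  ∂-reachable {S} A≐ {w} m with w ∈? S | ∂⁻ m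
  ... | yes w∈S | _ = w∈S
  ... | no w∉S | w∉A , _ , u , u∈A , e with to A≐ u∈A
  ...   | x , x∈X , walk = contradiction (from A≐ (x , x∈X , reach-snoc walk e w∉S)) w∉A

  record FurthestMinCut (X F : Subset n) (l : ℕ) : Set where
    field
      minimum  : ∀ {R} → IsCut X F R → l ≤ cost F R
      K        : Subset n
      K-cut    : IsCut X F K
      K-closed : Closed X K
      K-cost   : cost F K ≡ l
      beyond-K : ∀ {R w} → IsCut X F R → cost F R ≡ l → w ∈ ∂ F K → w ∉ R

  module FurthestFrom {X F l} (minimum : ∀ {R} → IsCut X F R → l ≤ cost F R)
    {Rx} (Rx-cut : IsCut X F Rx) (Rx-cost : cost F Rx ≡ l)
    (Rx-maximal : ∀ {R} → IsCut X F R → cost F R ≡ l → Rx ⊆ R → R ⊆ Rx)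
    {K} (K≐ : K ≐ Reachable E (∁ Rx) X) where

    -- By uncrossing, Rx contains every minimum cut.
    minimum-⊆-Rx : ∀ {R} → IsCut X F R → cost F R ≡ l → R ⊆ Rx
    minimum-⊆-Rx {R} R-cut R-cost =
      Rx-maximal (cut-∪ R-cut Rx-cut) ∪-cost (q⊆p∪q R Rx) ∘ p⊆p∪q Rx
      where
      ∪-cost : cost F (R ∪ Rx) ≡ l
      ∪-cost = ≤-antisym
        (≤-trans (cost-∪-minimum minimum R-cut Rx-cut Rx-cost) (≤-reflexive R-cost))
        (minimum (cut-∪ R-cut Rx-cut))

    K⊆Rx : K ⊆ Rx
    K⊆Rx v∈K = let (_ , _ , walk) = to K≐ v∈K in x∉∁p⇒x∈p (reach-end walk)

    ∂K-outside-Rx : ∀ {w} → w ∈ ∂ F K → w ∉ Rx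
    ∂K-outside-Rx = x∈∁p⇒x∉p ∘ ∂-reachable K≐

    -- The cut of K lies outside Rx, hence inside the cut of Rx.
    ∂K⊆∂Rx : ∂ F K ⊆ ∂ F Rx
    ∂K⊆∂Rx m with ∂⁻ m
    ... | _ , w∉F , _ , u∈K , e = ∂⁺ (∂K-outside-Rx m) w∉F (K⊆Rx u∈K) e

    K-cut : IsCut X F K
    K-cut = record
      { sources       = λ x∈X → from K≐ (_ , x∈X , here (x∈p⇒x∉∁p (sources Rx-cut x∈X)))
      ; terminal-free = terminal-free Rx-cut ∘ K⊆Rx
      ; deletion-free = deletion-free Rx-cut ∘ K⊆Rx
      ; deletable     = deletable Rx-cut ∘ ∂K⊆∂Rx
      }

    furthest : FurthestMinCut X F l
    furthest = record
      { minimum  = minimum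
      ; K        = K
      ; K-cut    = K-cut
      ; K-closed = reachable-closed K≐
      ; K-cost   = ≤-antisym (≤-trans (p⊆q⇒∣p∣≤∣q∣ ∂K⊆∂Rx) (≤-reflexive Rx-cost)) (minimum K-cut)
      ; beyond-K = λ R-cut R-cost w∈∂K w∈R → ∂K-outside-Rx w∈∂K (minimum-⊆-Rx R-cut R-cost w∈R)
      }

  -- Classically, if some X-cut exists then a furthest minimum cut exists: take a
  -- minimum cut Rx with the smallest complement.
  ¬¬-furthestMinCut : ∀ {X F R₀} → IsCut X F R₀ → DoubleNegation (∃ (FurthestMinCut X F))
  ¬¬-furthestMinCut {X} {F} R₀-cut = do
    (Rm , Rm-cut , Rm-minimal) ← ¬¬-minimum (IsCut X F) (cost F) R₀-cut
    (Rx , (Rx-cut , Rx-cost) , Rx-largest) ←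
      ¬¬-minimum (λ R → IsCut X F R × cost F R ≡ cost F Rm) (∣_∣ ∘ ∁) (Rm-cut , refl)
    (K , K≐) ← ¬¬-comprehension (Reachable E (∁ Rx) X)
    return (cost F Rm , FurthestFrom.furthest (Rm-minimal _) Rx-cut Rx-cost
      (λ R-cut R-cost → least-complement-maximal Rx-largest (R-cut , R-cost)) K≐)

  module _ {X F l} (C : FurthestMinCut X F l) where
    open FurthestMinCut C

    K⊆important : ∀ {R} → Important X F R → K ⊆ R
    K⊆important imp = important-⊇-minimum minimum imp K-cut K-closed K-cost

    -- If the minimum cost is 0 then K is the only important cut: a walk leaving K
    -- would cross the empty cut ∂ F K.
    important-unique : ∀ {R} → l ≡ 0 → Important X F R → R ≡ K
    important-unique {R} refl imp = ⊆-antisym R⊆K (K⊆important imp)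
      where
      R⊆K : R ⊆ K
      R⊆K v∈R with closed imp v∈R
      ... | x , x∈X , walk with escape (sources K-cut x∈X) walk
      ...   | inj₁ v∈K = v∈K
      ...   | inj₂ (s , s∉∁R , s∉K , _ , u∈K , e) = contradiction K-cost
              (>⇒≢ (∈⇒∣∣>0 (∂⁺ s∉K (deletion-free (cut imp) (x∉∁p⇒x∈p s∉∁R)) u∈K e)))

    important-split : ∀ {R u} → u ∈ ∂ F K → Important X F R → u ∈ ∂ F R ⊎ u ∈ R
    important-split {R} {u} u∈∂K imp with u ∈? R | ∂⁻ u∈∂K
    ... | yes u∈R | _ = inj₂ u∈R
    ... | no u∉R | _ , u∉F , _ , w∈K , e = inj₁ (∂⁺ u∉R u∉F (K⊆important imp w∈K) e)

    add-source-minimum : ∀ {R u} → u ∈ ∂ F K → IsCut (X ∪ ⁅ u ⁆) F R → suc l ≤ cost F R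
    add-source-minimum {u = u} u∈∂K c = ≤∧≢⇒< (minimum X-cut) λ l≡cost →
      beyond-K X-cut (sym l≡cost) u∈∂K (sources c (q⊆p∪q X ⁅ u ⁆ (x∈⁅x⁆ u)))
      where
      X-cut = cut-fewer-sources (p⊆p∪q ⁅ u ⁆) c

  delete-minimum : ∀ {X F l u} → (∀ {R} → IsCut X F R → l ≤ cost F R) → u ∉ Vinf →
    ∀ {R} → IsCut X (F ∪ ⁅ u ⁆) R → l ≤ suc (cost (F ∪ ⁅ u ⁆) R)
  delete-minimum minimum u∉Vinf c = ≤-trans (minimum (cut-undelete u∉Vinf c)) cost-undelete

  ImportantWithin : ℕ → Subset n → Subset n → Subset n → Set
  ImportantWithin k X F R = Important X F R × cost F R ≤ k

  -- Branch on a vertex u of the cut of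
  -- the furthest minimum cut: cuts with u in their cut are important after deleting u
  -- (k and the minimum drop by one), the others contain u and are important after
  -- making u a source (the minimum rises by one).
  mutual
    count-important : ∀ m {k b X F} → k + k ≤ m + b → (∀ {R} → IsCut X F R → b ≤ cost F R) →
      ∀ {L} → Unique L → All (ImportantWithin k X F) L → DoubleNegation (length L ≤ 2 ^ m)
    count-important m _ _ {[]} _ _ = return z≤n
    count-important m {b = b} budget lower uniq all@((imp₀ , cost₀≤k) ∷ _) = do
      (l , C) ← ¬¬-furthestMinCut (cut imp₀)
      let b≤l = subst (b ≤_) (FurthestMinCut.K-cost C) (lower (FurthestMinCut.K-cut C))
      count-beyond m C (≤-trans (FurthestMinCut.minimum C (cut imp₀)) cost₀≤k)
                       (≤-trans budget (+-monoʳ-≤ m b≤l)) uniq all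

    count-beyond : ∀ m {k l X F} → FurthestMinCut X F l → l ≤ k → k + k ≤ m + l →
      ∀ {L} → Unique L → All (ImportantWithin k X F) L → DoubleNegation (length L ≤ 2 ^ m)
    count-beyond m {l = zero} C _ _ uniq all = return (≤-trans
      (unique-constant uniq (All.map (important-unique C refl ∘ proj₁) all)) (m^n>0 2 m))
    count-beyond zero {suc k} {suc l} C (s≤s l≤k) budget _ _ =
      contradiction budget (budget-exhausted {k} l≤k)
    count-beyond (suc m) {suc k} {suc l} {X} {F} C (s≤s l≤k) budget {L} uniq all = do
      bound-delete ← count-important m (budget-delete {k} budget) lower-delete
                       (Unique.filter⁺ u∈∂? uniq) all-delete
      bound-add ← count-important m (budget-add-source {suc k} budget) (add-source-minimum C u∈∂K)
                    (Unique.filter⁺ (¬? ∘ u∈∂?) uniq) all-add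
      return (begin
        length L                                    ≡⟨ length-filter-split u∈∂? L ⟨
        length (filter u∈∂? L) + length (filter (¬? ∘ u∈∂?) L)
                                                    ≤⟨ +-mono-≤ bound-delete bound-add ⟩
        2 ^ m + 2 ^ m                               ≡⟨ 2^m+2^m≡2^[1+m] m ⟩
        2 ^ suc m                                   ∎)
      where
      open ≤-Reasoning
      open FurthestMinCut C
      ∂K-nonempty : Nonempty (∂ F K)
      ∂K-nonempty = ∣∣>0⇒nonempty (∂ F K) (subst (0 <_) (sym K-cost) (s≤s z≤n))
      u : Fin n
      u = proj₁ ∂K-nonempty
      u∈∂K : u ∈ ∂ F K
      u∈∂K = proj₂ ∂K-nonempty
      u∈∂? : ∀ R → Dec (u ∈ ∂ F R)
      u∈∂? R = u ∈? ∂ F R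
      lower-delete : ∀ {R} → IsCut X (F ∪ ⁅ u ⁆) R → l ≤ cost (F ∪ ⁅ u ⁆) R
      lower-delete = ≤-pred ∘ delete-minimum minimum (deletable K-cut u∈∂K)
      all-delete : All (ImportantWithin k X (F ∪ ⁅ u ⁆)) (filter u∈∂? L)
      all-delete = All.map (λ ((imp , cost≤) , u∈∂R) →
          important-delete u∈∂R imp , ≤-pred (≤-trans (cost-delete u∈∂R) cost≤))
        (All.zip (filter⁺ u∈∂? all , all-filter u∈∂? L))
      all-add : All (ImportantWithin (suc k) (X ∪ ⁅ u ⁆) F) (filter (¬? ∘ u∈∂?) L)
      all-add = All.map (λ ((imp , cost≤) , u∉∂R) →
          [ (λ u∈∂R → contradiction u∈∂R u∉∂R) , (λ u∈R → important-add-source u∈R imp , cost≤) ]′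
          (important-split C u∈∂K imp))
        (All.zip (filter⁺ (¬? ∘ u∈∂?) all , all-filter (¬? ∘ u∈∂?) L))

  reach-set-cut : ∀ {x S A} → IsSeparator E Vinf ⁅ x ⁆ T S → A ≐ Reachable E S ⁅ x ⁆ →
    IsCut ⁅ x ⁆ ∅ A
  reach-set-cut (_ , _ , _ , avoids , separates) A≐ = record
    { sources       = λ {y} y∈x → from A≐ (y , y∈x , here λ y∈S → proj₁ (avoids y y∈S) y∈x)
    ; terminal-free = λ v∈A v∈T → let (y , y∈x , walk) = to A≐ v∈A in separates y _ y∈x v∈T walk
    ; deletion-free = λ _ → ∉⊥
    ; deletable     = λ {v} v∈∂A → proj₂ (proj₂ (avoids v (∂-reachable A≐ v∈∂A)))
    }

  -- Every vertex of a minimal x–T separator S has an in-neighbour reachable from x: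
  -- otherwise S - s would still separate.
  minimal-separator⊆∂ : ∀ {x S A} → IsMinimalSeparator E Vinf ⁅ x ⁆ T S →
    A ≐ Reachable E S ⁅ x ⁆ → S ⊆ ∂ ∅ A
  minimal-separator⊆∂ {x} {S} {A} ((ne₁ , ne₂ , disjoint , avoids , separates) , minimal) A≐ {s} s∈S
    with s ∈? ∂ ∅ A
  ... | yes s∈∂A = s∈∂A
  ... | no s∉∂A = contradiction
                    (ne₁ , ne₂ , disjoint , (λ v → avoids v ∘ p─q⊆p S ⁅ s ⁆) , separates′)
                    (minimal (S - s) (x∈p⇒p-x⊂p s∈S))
    where
    s∉A : s ∉ A
    s∉A s∈A = let (_ , _ , walk) = to A≐ s∈A in reach-end walk s∈S
    separates′ : ∀ y t → y ∈ ⁅ x ⁆ → t ∈ T → ¬ Reach E (S - s) y t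
    separates′ y t y∈x t∈T walk with first-visit walk
    ... | inj₁ walk′ = separates y t y∈x t∈T walk′
    ... | inj₂ (inj₁ refl) = proj₁ (avoids s s∈S) y∈x
    ... | inj₂ (inj₂ (u , walk-u , e)) = s∉∂A (∂⁺ s∉A ∉⊥ (from A≐ (y , y∈x , walk-u)) e)

  minimal-separator-≡∂ : ∀ {x S A} → IsMinimalSeparator E Vinf ⁅ x ⁆ T S →
    A ≐ Reachable E S ⁅ x ⁆ → ∂ ∅ A ≡ S
  minimal-separator-≡∂ min A≐ = ⊆-antisym (∂-reachable A≐) (minimal-separator⊆∂ min A≐)

  -- Let S be a minimal v–T and z–T separator with reach sets
  -- A (of v) and R (of z), and let R′ ⊃ R be a closed {z}-cut.  Then S′ = ∂ ∅ (A ∪ R′)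
  -- is a v–T separator no larger than ∂ ∅ R′ whose reach set from v strictly grows.
  module Exchange (T⊆Vinf : T ⊆ Vinf) {S v z A R R′}
    (v-min : IsMinimalSeparator E Vinf ⁅ v ⁆ T S) (A≐ : A ≐ Reachable E S ⁅ v ⁆)
    (z-min : IsMinimalSeparator E Vinf ⁅ z ⁆ T S) (R≐ : R ≐ Reachable E S ⁅ z ⁆)
    (R′-cut : IsCut ⁅ z ⁆ ∅ R′) (R′-closed : Closed ⁅ z ⁆ R′) (R⊂R′ : R ⊂ R′) where

    D S′ : Subset n
    D = A ∪ R′
    S′ = ∂ ∅ D

    v∈D : v ∈ D
    v∈D = p⊆p∪q R′ (sources (reach-set-cut (proj₁ v-min) A≐) (x∈⁅x⁆ v))

    S′-outside-D : ∀ {w} → w ∈ S′ → w ∉ D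
    S′-outside-D = proj₁ ∘ ∂⁻

    -- S′ ⊆ ∂R′: a vertex of S′ entered from A lies in ∂A ⊆ S = ∂R, so it is also
    -- entered from R ⊆ R′.
    S′⊆∂R′ : S′ ⊆ ∂ ∅ R′
    S′⊆∂R′ m with ∂⁻ m
    ... | w∉D , _ , u , u∈D , e with ∉∪ w∉D | x∈p∪q⁻ A R′ u∈D
    ...   | _ , w∉R′ | inj₂ u∈R′ = ∂⁺ w∉R′ ∉⊥ u∈R′ e
    ...   | w∉A , w∉R′ | inj₁ u∈A
      with ∂⁻ (minimal-separator⊆∂ z-min R≐ (∂-reachable A≐ (∂⁺ w∉A ∉⊥ u∈A e)))
    ...     | _ , _ , u′ , u′∈R , e′ = ∂⁺ w∉R′ ∉⊥ (proj₁ R⊂R′ u′∈R) e′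

    stays-in-D : ∀ {d w} → d ∈ D → Reach E S′ d w → w ∈ D
    stays-in-D d∈D walk with escape d∈D walk
    ... | inj₁ w∈D = w∈D
    ... | inj₂ (s , s∉S′ , s∉D , _ , u∈D , e) = contradiction (∂⁺ s∉D ∉⊥ u∈D e) s∉S′

    -- S′ separates v from T: such walks stay in A ∪ R′, which contains no terminal.
    S′-separates : IsSeparator E Vinf ⁅ v ⁆ T S′
    S′-separates with proj₁ v-min
    ... | ne₁ , ne₂ , disjoint , _ , separates = ne₁ , ne₂ , disjoint , avoids′ , separates′
      where
      avoids′ : ∀ w → w ∈ S′ → w ∉ ⁅ v ⁆ × w ∉ T × w ∉ Vinf
      avoids′ w w∈S′ =
        (λ w∈v → S′-outside-D w∈S′ (subst (_∈ D) (sym (x∈⁅y⁆⇒x≡y v w∈v)) v∈D)) ,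
        w∉Vinf ∘ T⊆Vinf , w∉Vinf
        where
        w∉Vinf = deletable R′-cut (S′⊆∂R′ w∈S′)
      separates′ : ∀ y t → y ∈ ⁅ v ⁆ → t ∈ T → ¬ Reach E S′ y t
      separates′ y t y∈v t∈T walk
        with x∈p∪q⁻ A R′ (stays-in-D (subst (_∈ D) (sym (x∈⁅y⁆⇒x≡y v y∈v)) v∈D) walk)
      ... | inj₁ t∈A = let (y′ , y′∈v , walk′) = to A≐ t∈A in separates y′ t y′∈v t∈T walk′
      ... | inj₂ t∈R′ = terminal-free R′-cut t∈R′ t∈T

    S′-small : ∣ S′ ∣ ≤ cost ∅ R′
    S′-small = p⊆q⇒∣p∣≤∣q∣ S′⊆∂R′

    -- Walks from v avoiding S stay in A, which S′ does not meet.
    reach-⊆ : ∀ w → Reachable E S ⁅ v ⁆ w → Reachable E S′ ⁅ v ⁆ w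
    reach-⊆ w (x , x∈v , walk) = x , x∈v ,
      reach-mono (x∉p⇒x∈∁p ∘ proj₁ ∘ ∉∪ ∘ S′-outside-D)
                 (reachable-inside A≐ (x , x∈v , here (reach-start walk)) walk)

    -- A walk inside R′ from z to a vertex outside R leaves R through some s ∈ S;
    -- s is reachable from v avoiding S′ but not avoiding S.
    reach-grows : StrictlyIncluded E Vinf (Reachable E S ⁅ v ⁆) (Reachable E S′ ⁅ v ⁆)
    reach-grows with proj₂ R⊂R′
    ... | w , w∈R′ , w∉R with R′-closed w∈R′
    ...   | x , x∈z , walk with escape (sources (reach-set-cut (proj₁ z-min) R≐) x∈z) walk
    ...     | inj₁ w∈R = contradiction w∈R w∉R
    ...     | inj₂ (s , s∉∁R′ , s∉R , _ , u∈R , e) = reach-⊆ , s , s-reachable′ , s-unreachable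
      where
      s∈S : s ∈ S
      s∈S = ∂-reachable R≐ (∂⁺ s∉R ∉⊥ u∈R e)
      s-reachable′ : Reachable E S′ ⁅ v ⁆ s
      s-reachable′ with ∂⁻ (minimal-separator⊆∂ v-min A≐ s∈S)
      ... | _ , _ , a , a∈A , e′ with reach-⊆ a (to A≐ a∈A)
      ...   | y , y∈v , walk-a = y , y∈v , reach-snoc walk-a e′
                (λ s∈S′ → S′-outside-D s∈S′ (q⊆p∪q A R′ (x∉∁p⇒x∈p s∉∁R′)))
      s-unreachable : ¬ Reachable E S ⁅ v ⁆ s
      s-unreachable (_ , _ , walk-s) = reach-end walk-s s∈S

  -- If S is an important v–T separator and a minimal z–T separator, then the reach set
  -- of z is an important {z}-cut: a cheaper enlargement would, by the exchange argument,
  -- give a v–T separator contradicting the importance of S.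
  shadow-important : T ⊆ Vinf → ∀ {S v z A R} → IsImportantSeparator E Vinf ⁅ v ⁆ T S →
    A ≐ Reachable E S ⁅ v ⁆ → IsMinimalSeparator E Vinf ⁅ z ⁆ T S →
    R ≐ Reachable E S ⁅ z ⁆ → Important ⁅ z ⁆ ∅ R
  shadow-important T⊆Vinf (v-min , nothing-better) A≐ z-min R≐ = record
    { cut       = reach-set-cut (proj₁ z-min) R≐
    ; closed    = reachable-closed R≐
    ; important = λ R′-cut R′-closed R⊂R′ → ≰⇒> λ R′-cheaper →
        let open Exchange T⊆Vinf v-min A≐ z-min R≐ R′-cut R′-closed R⊂R′
            S′-no-larger = ≤-trans S′-small
              (≤-trans R′-cheaper (≤-reflexive (cong ∣_∣ (minimal-separator-≡∂ z-min R≐))))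
        in nothing-better (S′ , S′-separates , S′-no-larger , reach-grows)
    }

  ¬¬-shadow-cut : T ⊆ Vinf → ∀ {p z S} →
    InI E Vinf T p S × InExactReverseShadow E Vinf T S z →
    DoubleNegation (∃ λ R → ImportantWithin p ⁅ z ⁆ ∅ R × ∂ ∅ R ≡ S)
  ¬¬-shadow-cut T⊆Vinf {p} {z} {S} ((v , _ , v-imp , ∣S∣≤p) , _ , z-min) = do
    (A , A≐) ← ¬¬-comprehension (Reachable E S ⁅ v ⁆)
    (R , R≐) ← ¬¬-comprehension (Reachable E S ⁅ z ⁆)
    let ∂R≡S = minimal-separator-≡∂ z-min R≐
    return (R , (shadow-important T⊆Vinf v-imp A≐ z-min R≐ ,
                 subst (λ X → ∣ X ∣ ≤ p) (sym ∂R≡S) ∣S∣≤p) , ∂R≡S)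

-- Every counted member S of 𝓘_p
-- is the cut ∂ ∅ R of an important {z}-cut R of cost at most p, and distinct S give
-- distinct R; there are at most 2 ^ (p + p) = 4 ^ p such R.  As the bound is a decidable
-- statement, the classical argument proves it outright.
lemma9 : (n : ℕ) (E : Fin n → Fin n → Set) (T Vinf : Subset n) → T ⊆ Vinf →
    (p : ℕ) (z : Fin n) (L : List (Subset n)) → Unique L →
    All (λ S → InI E Vinf T p S × InExactReverseShadow E Vinf T S z) L →
    length L ≤ 4 ^ p
lemma9 n E T Vinf T⊆Vinf p z L uniq members =
  decidable-stable (length L ≤? 4 ^ p) (¬¬-decidable E >>= λ E? → let open Cuts E E? T Vinf in do
    (Rs , Rs-important , ∂Rs≡L) ← ¬¬-preimages (∂ ∅) (¬¬-shadow-cut T⊆Vinf) members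
    bound ← count-important (p + p) (≤-reflexive (sym (+-identityʳ (p + p)))) (λ _ → z≤n)
              (Unique.map⁻ (subst Unique (sym ∂Rs≡L) uniq)) Rs-important
    return (begin
      length L               ≡⟨ cong length ∂Rs≡L ⟨
      length (map (∂ ∅) Rs)  ≡⟨ length-map (∂ ∅) Rs ⟩
      length Rs              ≤⟨ bound ⟩
      2 ^ (p + p)            ≡⟨ 2^[p+p]≡4^p p ⟩
      4 ^ p                  ∎))
  where open ≤-Reasoning
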